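{- Let $R$ be a commutative ring with unity, $(G,\alpha)$ an edge-labeled graph over $R$ with vertex set $V$, and $I$ an ideal of $R$; let $\overline{\alpha}$ be the edge labeling of $G$ over $R/I$ given by $\overline{\alpha}(uv)=\alpha(uv)+I$. Suppose there is a second ideal $J$ of $R$ with $I\cap J=(0)$. Then: (1) If $q:V\to R/I$ is a spline on $(G,\overline{\alpha})$ with $q(u)=x_u+I$ for each vertex $u$, and $j\in J$, then the function $q_j:V\to R$, $q_j(u)=x_uj$, is well defined (independent of the choice of representatives $x_u$) and is a spline on $(G,\alpha)$. (2) If moreover $R=I+J$, then there is a unique $j_0\in J$ such that $\overline{q_{j_0}}=q$ for every spline $q$ on $(G,\overline{\alpha})$, where $\overline{q_{j_0}}(u)=q_{j_0}(u)+I$.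
   Context: An edge labeling of a graph $G=(V,E)$ over a commutative ring $S$ is a function from $E$ to the set of ideals of $S$. A spline on a labeled graph $(G,\alpha)$ over $S$ is a function $p:V\to S$ with $p(u)-p(v)\in\alpha(uv)$ for every edge $uv$. -}

module Defs where

open import Level using (Level; _⊔_; suc)
open import Algebra.Bundles using (CommutativeRing)
open import Data.Product using (Σ; ∃; _×_; _,_)

module _ {c ℓ : Level} (R : CommutativeRing c ℓ) where
  open CommutativeRing R

  record Ideal (p : Level) : Set (c ⊔ ℓ ⊔ suc p) where
    field
      _∈I : Carrier → Set p
      ∈-resp-≈ : ∀ {x y} → x ≈ y → x ∈I → y ∈I
      0∈ : 0# ∈I
      +-closed : ∀ {x y} → x ∈I → y ∈I → (x + y) ∈I
      neg-closed : ∀ {x} → x ∈I → (- x) ∈I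
      *-closed : ∀ r {x} → x ∈I → (r * x) ∈I

  open Ideal public

  _∈_ : ∀ {p} → Carrier → Ideal p → Set p
  x ∈ I = _∈I I x

  _≈[_]_ : ∀ {p} → Carrier → Ideal p → Carrier → Set p
  x ≈[ I ] y = (x - y) ∈ I

  _∈⊕_,_ : ∀ {p q} → Carrier → Ideal p → Ideal q → Set (c ⊔ ℓ ⊔ p ⊔ q)
  x ∈⊕ A , B = Σ Carrier λ a → Σ Carrier λ b → (a ∈ A) × (b ∈ B) × (x ≈ a + b)

  IsSpline : ∀ {v e p} {V : Set v} (E : V → V → Set e)
             (α : ∀ {u w} → E u w → Ideal p) → (V → Carrier) → Set (v ⊔ e ⊔ p)
  IsSpline E α f = ∀ {u w} (uw : E u w) → (f u - f w) ∈ α uw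

  -- A spline on (G, ᾱ) over R/I, where ᾱ(uw) = α(uw) + I, given by a choice of
  -- representatives x : V → R (so q(u) = x u + I).  The condition
  -- q(u) - q(w) ∈ ᾱ(uw) in R/I is exactly x u - x w ∈ α(uw) + I in R.
  IsQuotSpline : ∀ {v e p q} {V : Set v} (E : V → V → Set e)
                 (α : ∀ {u w} → E u w → Ideal p) (I : Ideal q) →
                 (V → Carrier) → Set (c ⊔ ℓ ⊔ v ⊔ e ⊔ p ⊔ q)
  IsQuotSpline E α I x = ∀ {u w} (uw : E u w) → (x u - x w) ∈⊕ α uw , I

-- Since I ∩ J = 0, the product of an element of I and an element of J
-- vanishes, so multiplying by j ∈ J kills every ambiguity modulo I; this makes q_j well
-- defined and turns the I-component of each difference x_u - x_w ∈ α(uw) + I into 0.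
-- If R = I + J, write 1 = i + j₀; then j₀ ≡ 1 (mod I), so x j₀ ≡ x (mod I) for all x,
-- and any other j ∈ J doing the same for the constant spline 1 satisfies j ≡ 1 ≡ j₀
-- (mod I), whence j - j₀ ∈ I ∩ J = 0.
module Submission where

open import Defs
open import Algebra.Bundles using (CommutativeRing)
open import Data.Product using (Σ; _×_; _,_)
import Algebra.Properties.Ring as RingProperties
import Algebra.Properties.AbelianGroup as AbelianGroupProperties
import Relation.Binary.Reasoning.Setoid as SetoidReasoning

module CongruenceModIdeal {c ℓ q} (R : CommutativeRing c ℓ) (I : Ideal R q) where
  open CommutativeRing R
  open RingProperties ring using (x[y-z]≈xy-xz)
  open AbelianGroupProperties +-abelianGroup using (⁻¹-anti-homo‿-)
  open SetoidReasoning setoid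

  *-closedʳ : ∀ r {x} → _∈_ R x I → _∈_ R (x * r) I
  *-closedʳ r x∈I = ∈-resp-≈ I (*-comm r _) (*-closed I r x∈I)

  ≈[]-sym : ∀ {x y} → _≈[_]_ R x I y → _≈[_]_ R y I x
  ≈[]-sym {x} {y} x≡y = ∈-resp-≈ I (⁻¹-anti-homo‿- x y) (neg-closed I x≡y)

  ≈[]-trans : ∀ {x y z} → _≈[_]_ R x I y → _≈[_]_ R y I z → _≈[_]_ R x I z
  ≈[]-trans {x} {y} {z} x≡y y≡z = ∈-resp-≈ I telescope (+-closed I x≡y y≡z)
    where
    telescope : (x - y) + (y - z) ≈ x - z
    telescope = begin
      (x - y) + (y - z)    ≈⟨ +-assoc x (- y) (y - z) ⟩
      x + (- y + (y - z))  ≈⟨ +-congˡ (+-assoc (- y) y (- z)) ⟨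
      x + ((- y + y) - z)  ≈⟨ +-congˡ (+-congʳ (-‿inverseˡ y)) ⟩
      x + (0# - z)         ≈⟨ +-congˡ (+-identityˡ (- z)) ⟩
      x - z                ∎

  ≈[]-respˡ : ∀ {x x′ y} → x ≈ x′ → _≈[_]_ R x I y → _≈[_]_ R x′ I y
  ≈[]-respˡ x≈x′ = ∈-resp-≈ I (+-congʳ x≈x′)

  ≈[]-*-congˡ : ∀ x {y z} → _≈[_]_ R y I z → _≈[_]_ R (x * y) I (x * z)
  ≈[]-respʳ : ∀ {x y y′} → y ≈ y′ → _≈[_]_ R x I y → _≈[_]_ R x I y′
  ≈[]-respʳ y≈y′ = ∈-resp-≈ I (+-congˡ (-‿cong y≈y′))

  ≈[]-*-congˡ x {y} {z} y≡z = ∈-resp-≈ I (x[y-z]≈xy-xz x y z) (*-closed I x y≡z)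

  ≈[]-1⇒*≈[] : ∀ {j} → _≈[_]_ R j I 1# → ∀ x → _≈[_]_ R (x * j) I x
  ≈[]-1⇒*≈[] j≡1 x = ≈[]-respʳ (*-identityʳ x) (≈[]-*-congˡ x j≡1)

  ≈+∈⇒≈[] : ∀ {x y i} → x ≈ i + y → _∈_ R i I → _≈[_]_ R x I y
  ≈+∈⇒≈[] {x} {y} {i} x≈i+y i∈I = ∈-resp-≈ I (sym x-y≈i) i∈I
    where
    x-y≈i : x - y ≈ i
    x-y≈i = begin
      x - y        ≈⟨ +-congʳ x≈i+y ⟩
      i + y - y    ≈⟨ +-assoc i y (- y) ⟩
      i + (y - y)  ≈⟨ +-congˡ (-‿inverseʳ y) ⟩
      i + 0#       ≈⟨ +-identityʳ i ⟩
      i            ∎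

const-isQuotSpline : ∀ {c ℓ v e p q} (R : CommutativeRing c ℓ) → let open CommutativeRing R in
  {V : Set v} (E : V → V → Set e) (α : ∀ {u w} → E u w → Ideal R p) (I : Ideal R q) →
  ∀ r → IsQuotSpline R E α I (λ _ → r)
const-isQuotSpline R E α I r uw =
  0# , 0# , 0∈ (α uw) , 0∈ I , trans (-‿inverseʳ r) (sym (+-identityʳ 0#))
  where open CommutativeRing R

module DisjointIdeals {c ℓ q} (R : CommutativeRing c ℓ) (I J : Ideal R q)
  (I∩J≈0 : ∀ x → _∈_ R x I → _∈_ R x J → CommutativeRing._≈_ R x (CommutativeRing.0# R))
  where
  open CommutativeRing R
  open RingProperties ring using ([y-z]x≈yx-zx)
  open AbelianGroupProperties +-abelianGroup using (x∙y⁻¹≈ε⇒x≈y)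
  open CongruenceModIdeal R I using (*-closedʳ)
  open SetoidReasoning setoid

  ∈I∧∈J⇒*≈0 : ∀ {x j} → _∈_ R x I → _∈_ R j J → x * j ≈ 0#
  ∈I∧∈J⇒*≈0 {x} {j} x∈I j∈J = I∩J≈0 (x * j) (*-closedʳ _ x∈I) (*-closed J x j∈J)

  ≈[I]∧∈J⇒*≈ : ∀ {x y j} → _≈[_]_ R x I y → _∈_ R j J → x * j ≈ y * j
  ≈[I]∧∈J⇒*≈ {x} {y} {j} x≡y j∈J =
    x∙y⁻¹≈ε⇒x≈y (x * j) (y * j) (trans (sym ([y-z]x≈yx-zx j x y)) (∈I∧∈J⇒*≈0 x≡y j∈J))

  ≈[I]∧∈J⇒≈ : ∀ {a b} → _∈_ R a J → _∈_ R b J → _≈[_]_ R a I b → a ≈ b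
  ≈[I]∧∈J⇒≈ {a} {b} a∈J b∈J a≡b =
    x∙y⁻¹≈ε⇒x≈y a b (I∩J≈0 (a - b) a≡b (+-closed J a∈J (neg-closed J b∈J)))

  *-isSpline : ∀ {v e p} {V : Set v} (E : V → V → Set e) (α : ∀ {u w} → E u w → Ideal R p) →
    ∀ {x} → IsQuotSpline R E α I x → ∀ {j} → _∈_ R j J → IsSpline R E α (λ u → x u * j)
  *-isSpline E α {x} x-spline {j} j∈J {u} {w} uw with x-spline uw
  ... | a , b , a∈α , b∈I , xu-xw≈a+b = ∈-resp-≈ (α uw) (sym difference≈aj) (CongruenceModIdeal.*-closedʳ R (α uw) j a∈α)
    where
    difference≈aj : x u * j - x w * j ≈ a * j
    difference≈aj = begin
      x u * j - x w * j  ≈⟨ [y-z]x≈yx-zx j (x u) (x w) ⟨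
      (x u - x w) * j    ≈⟨ *-congʳ xu-xw≈a+b ⟩
      (a + b) * j        ≈⟨ distribʳ j a b ⟩
      a * j + b * j      ≈⟨ +-congˡ (∈I∧∈J⇒*≈0 b∈I j∈J) ⟩
      a * j + 0#         ≈⟨ +-identityʳ (a * j) ⟩
      a * j              ∎

theorem3p3 : ∀ {c ℓ v e p} (R : CommutativeRing c ℓ) → let open CommutativeRing R in
    {V : Set v} (E : V → V → Set e) (α : ∀ {u w} → E u w → Ideal R p)
    (I J : Ideal R p) →
    (∀ x → _∈_ R x I → _∈_ R x J → x ≈ 0#) →
    -- (1) well-definedness and spline property of q_j
    ((∀ (x x′ : V → Carrier) → IsQuotSpline R E α I x →
        (∀ u → _≈[_]_ R (x u) I (x′ u)) →
        ∀ j → _∈_ R j J → ∀ u → x u * j ≈ x′ u * j)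
     × (∀ (x : V → Carrier) → IsQuotSpline R E α I x →
        ∀ j → _∈_ R j J → IsSpline R E α (λ u → x u * j)))
    ×
    -- (2) if R = I + J (and the graph has a vertex), a unique j₀ ∈ J with q_{j₀} + I = q
    ((∀ r → _∈⊕_,_ R r I J) → V →
     Σ Carrier λ j₀ → _∈_ R j₀ J
       × (∀ (x : V → Carrier) → IsQuotSpline R E α I x →
            ∀ u → _≈[_]_ R (x u * j₀) I (x u))
       × (∀ j → _∈_ R j J →
            (∀ (x : V → Carrier) → IsQuotSpline R E α I x →
               ∀ u → _≈[_]_ R (x u * j) I (x u)) →
            j ≈ j₀))
theorem3p3 R E α I J I∩J≈0 =
  ( (λ x x′ _ x≡x′ j j∈J u → ≈[I]∧∈J⇒*≈ (x≡x′ u) j∈J)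
  , (λ x x-spline j j∈J → *-isSpline E α x-spline j∈J) )
  , λ R=I+J v₀ →
      let (i , j₀ , i∈I , j₀∈J , 1≈i+j₀) = R=I+J 1#
          1≡j₀ = ≈+∈⇒≈[] 1≈i+j₀ i∈I
      in  j₀ , j₀∈J
        , (λ x _ u → ≈[]-1⇒*≈[] (≈[]-sym 1≡j₀) (x u))
        , λ j j∈J j-fixes →
            let 1j≡1 = j-fixes (λ _ → 1#) (const-isQuotSpline R E α I 1#) v₀
                j≡1 = ≈[]-respˡ (*-identityˡ j) 1j≡1
            in  ≈[I]∧∈J⇒≈ j∈J j₀∈J (≈[]-trans j≡1 1≡j₀)
  where
  open CommutativeRing R
  open CongruenceModIdeal R I
  open DisjointIdeals R I J I∩J≈0
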